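{- In the category of inner univalent multirelations (objects sets, arrows $X\to Y$ the inner univalent multirelations $X\leftrightarrow\mathcal{P} Y$, composition Peleg composition, identities $1_X$), each homset is a complete lattice under $\subseteq$ (with arbitrary unions as sups), and Peleg composition preserves arbitrary unions in its first argument and non-empty unions in its second argument.
   Context: Multirelations are subsets of $X\times\mathcal{P} Y$; $R$ is inner univalent if each $B$ with $(a,B)\in R$ is empty or a singleton. $1_X = \{(a,\{a\})\mid a\in X\}$. Peleg composition: $R \ast S = \{(a,C) \mid \exists B.\ (a,B) \in R \wedge \exists f : Y \to \mathcal{P} Z.\ (\forall b \in B.\ (b,f(b)) \in S) \wedge C = \bigcup_{b \in B} f(b)\}$. -}

module Defs where

open import Level using (Level; suc; _⊔_; Lift)
open import Data.Product using (Σ; ∃; _×_; _,_)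
open import Data.Sum using (_⊎_)
open import Relation.Nullary using (¬_)
open import Relation.Binary.PropositionalEquality using (_≡_)

ℙ : ∀ {ℓ} → Set ℓ → Set (suc ℓ)
ℙ {ℓ} Y = Y → Set ℓ

_⟺_ : ∀ {a b} → Set a → Set b → Set (a ⊔ b)
A ⟺ B = (A → B) × (B → A)

MRel : ∀ {ℓ} → Set ℓ → Set ℓ → Set (suc (suc ℓ))
MRel {ℓ} X Y = X → ℙ Y → Set (suc ℓ)

IsEmpty : ∀ {ℓ} {Y : Set ℓ} → ℙ Y → Set ℓ
IsEmpty {Y = Y} B = ∀ (y : Y) → ¬ B y

IsSingleton : ∀ {ℓ} {Y : Set ℓ} → ℙ Y → Set ℓ
IsSingleton {Y = Y} B = Σ Y λ b → ∀ (y : Y) → B y ⟺ (y ≡ b)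

InnerUnivalent : ∀ {ℓ} {X Y : Set ℓ} → MRel X Y → Set (suc ℓ)
InnerUnivalent {X = X} {Y} R = ∀ (a : X) (B : ℙ Y) → R a B → IsEmpty B ⊎ IsSingleton B

1M : ∀ {ℓ} (X : Set ℓ) → MRel X X
1M X a B = Lift _ (∀ x → B x ⟺ (x ≡ a))

_∗_ : ∀ {ℓ} {X Y Z : Set ℓ} → MRel X Y → MRel Y Z → MRel X Z
_∗_ {Y = Y} {Z} R S a C =
  Σ (ℙ Y) λ B → R a B ×
  Σ (Y → ℙ Z) λ f → (∀ b → B b → S b (f b)) ×
  (∀ z → C z ⟺ (Σ Y λ b → B b × f b z))

_⊆M_ : ∀ {ℓ} {X Y : Set ℓ} → MRel X Y → MRel X Y → Set (suc ℓ)
_⊆M_ {X = X} {Y} R S = ∀ (a : X) (B : ℙ Y) → R a B → S a B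

_≐M_ : ∀ {ℓ} {X Y : Set ℓ} → MRel X Y → MRel X Y → Set (suc ℓ)
R ≐M S = (R ⊆M S) × (S ⊆M R)

⋃M : ∀ {ℓ} {X Y : Set ℓ} {I : Set (suc ℓ)} → (I → MRel X Y) → MRel X Y
⋃M {I = I} R a B = Σ I λ i → R i a B

{-# OPTIONS --safe #-}
-- Unions are computed pointwise, so the lattice facts and distributivity over
-- unions in the first argument are bookkeeping. For R ∗ ⋃M S ⊆ ⋃M (R ∗ S i), a witness (B, f) of the left side
-- picks for each b ∈ B possibly different indices i with (b, f b) ∈ S i; this is
-- repaired by inner univalence of R: B has at most one element, so one index
-- serves all of B, and for B = ∅ any index does, which is why I must be inhabited.
module Submission where

open import Defs
open import Level using (Level; suc)
open import Data.Product using (Σ; _×_; _,_; proj₁; proj₂)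
open import Data.Sum using (_⊎_; inj₁; inj₂)
open import Data.Empty using (⊥-elim)
open import Relation.Binary.PropositionalEquality using (refl; sym; subst)

module _ {ℓ : Level} {X Y : Set ℓ} {I : Set (suc ℓ)} (R : I → MRel X Y) where

  ⋃M-innerUnivalent : (∀ i → InnerUnivalent (R i)) → InnerUnivalent (⋃M R)
  ⋃M-innerUnivalent iu a B (i , r) = iu i a B r

  ⋃M-upperBound : ∀ i → R i ⊆M ⋃M R
  ⋃M-upperBound i a B r = i , r

  ⋃M-least : ∀ (T : MRel X Y) → (∀ i → R i ⊆M T) → ⋃M R ⊆M T
  ⋃M-least T R⊆T a B (i , r) = R⊆T i a B r

∗-distribʳ-⋃M : ∀ {ℓ} {X Y Z : Set ℓ} {I : Set (suc ℓ)} (R : I → MRel X Y) (S : MRel Y Z) →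
                (⋃M R ∗ S) ≐M ⋃M (λ i → R i ∗ S)
∗-distribʳ-⋃M R S =
    (λ { a C (B , (i , r) , f , fS , C≡⋃f) → i , B , r , f , fS , C≡⋃f })
  , (λ { a C (i , B , r , f , fS , C≡⋃f) → B , (i , r) , f , fS , C≡⋃f })

⋃M-∗-⊆-∗-⋃M : ∀ {ℓ} {X Y Z : Set ℓ} {I : Set (suc ℓ)} (R : MRel X Y) (S : I → MRel Y Z) →
              ⋃M (λ i → R ∗ S i) ⊆M (R ∗ ⋃M S)
⋃M-∗-⊆-∗-⋃M R S a C (i , B , r , f , fS , C≡⋃f) = B , r , f , (λ b b∈B → i , fS b b∈B) , C≡⋃f

uniformIndex : ∀ {a ℓ p} {I : Set a} {Y : Set ℓ} {B : ℙ Y} {P : I → Y → Set p} →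
               I → IsEmpty B ⊎ IsSingleton B →
               (∀ b → B b → Σ I λ i → P i b) → Σ I λ i → ∀ b → B b → P i b
uniformIndex i₀ (inj₁ B-empty) _ = i₀ , λ b b∈B → ⊥-elim (B-empty b b∈B)
uniformIndex {P = P} _ (inj₂ (b₀ , B-is-b₀)) choose
  with choose b₀ (proj₂ (B-is-b₀ b₀) refl)
... | i , Pib₀ = i , λ b b∈B → subst (P i) (sym (proj₁ (B-is-b₀ b) b∈B)) Pib₀

∗-⋃M-⊆-⋃M-∗ : ∀ {ℓ} {X Y Z : Set ℓ} {I : Set (suc ℓ)} (R : MRel X Y) (S : I → MRel Y Z) →
              I → InnerUnivalent R → (R ∗ ⋃M S) ⊆M ⋃M (λ i → R ∗ S i)
∗-⋃M-⊆-⋃M-∗ R S i₀ iuR a C (B , r , f , fS , C≡⋃f)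
  with uniformIndex i₀ (iuR a B r) fS
... | i , fSᵢ = i , B , r , f , fSᵢ , C≡⋃f

∗-distribˡ-⋃M : ∀ {ℓ} {X Y Z : Set ℓ} {I : Set (suc ℓ)} (R : MRel X Y) (S : I → MRel Y Z) →
                I → InnerUnivalent R → (R ∗ ⋃M S) ≐M ⋃M (λ i → R ∗ S i)
∗-distribˡ-⋃M R S i₀ iuR = ∗-⋃M-⊆-⋃M-∗ R S i₀ iuR , ⋃M-∗-⊆-∗-⋃M R S

lemma4p6 : ∀ {ℓ : Level} →
    -- homsets: arbitrary unions of inner univalent multirelations are inner univalent and are the sups w.r.t. ⊆
    (∀ {X Y : Set ℓ} {I : Set (suc ℓ)} (R : I → MRel X Y) →
      (∀ i → InnerUnivalent (R i)) →
      InnerUnivalent (⋃M R)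
      × (∀ i → R i ⊆M ⋃M R)
      × (∀ (T : MRel X Y) → InnerUnivalent T → (∀ i → R i ⊆M T) → ⋃M R ⊆M T))
    -- Peleg composition preserves arbitrary unions in its first argument
    × (∀ {X Y Z : Set ℓ} {I : Set (suc ℓ)} (R : I → MRel X Y) (S : MRel Y Z) →
      (∀ i → InnerUnivalent (R i)) → InnerUnivalent S →
      (⋃M R ∗ S) ≐M ⋃M (λ i → R i ∗ S))
    -- and non-empty unions in its second argument
    × (∀ {X Y Z : Set ℓ} {I : Set (suc ℓ)} (R : MRel X Y) (S : I → MRel Y Z) →
      I → InnerUnivalent R → (∀ i → InnerUnivalent (S i)) →
      (R ∗ ⋃M S) ≐M ⋃M (λ i → R ∗ S i))
lemma4p6 =
    (λ R iu → ⋃M-innerUnivalent R iu , ⋃M-upperBound R , λ T _ → ⋃M-least R T)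
  , (λ R S _ _ → ∗-distribʳ-⋃M R S)
  , (λ R S i₀ iuR _ → ∗-distribˡ-⋃M R S i₀ iuR)
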